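{- Let $\varphi$ be a primitive morphism in class $\mathcal{A}_1$ and let $\mathbf{u}$ be its fixed point. Then the set of factors of $\mathbf{u}$ contains infinitely many antipalindromes.
   Context: Words are over $\{0,1\}$, $\varepsilon$ the empty word. $\mathrm{E}$ is the antimorphism $\mathrm{E}(w_1\cdots w_n)=(1-w_n)\cdots(1-w_1)$; $w$ is an antipalindrome if $\mathrm{E}(w)=w$. A morphism $\varphi:\{0,1\}^*\to\{0,1\}^*$ belongs to class $\mathcal{A}_1$ if there are words $\mathfrak{p},\mathfrak{s}$ with $\mathfrak{p}\neq\varepsilon$, $\mathfrak{s}$ an antipalindrome, $\varphi(0)=\mathfrak{p}\mathfrak{s}$, $\varphi(1)=\mathrm{E}(\mathfrak{p})\mathfrak{s}$. A morphism is primitive if some power of it maps every letter to a word containing both letters. A fixed point of $\varphi$ is an infinite word $\mathbf{u}$ with $\varphi(\mathbf{u})=\mathbf{u}$. -}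

module Defs where

open import Data.Bool using (Bool; true; false; not)
open import Data.Nat using (ℕ; zero; suc; _+_; _≥_)
open import Data.List using (List; []; _∷_; _++_; map; reverse; concatMap; length)
open import Data.List.Membership.Propositional using (_∈_)
open import Data.Product using (Σ; _×_; ∃; ∃-syntax; _,_)
open import Relation.Binary.PropositionalEquality using (_≡_)
open import Relation.Nullary using (¬_)

-- Letters: false = 0, true = 1.  Finite words: List Bool.
Word : Set
Word = List Bool

InfWord : Set
InfWord = ℕ → Bool

E : Word → Word
E w = reverse (map not w)

IsAntipalindrome : Word → Set
IsAntipalindrome w = E w ≡ w

-- A morphism of {0,1}* is determined by the images of the letters.
Morphism : Set
Morphism = Bool → Word

apply : Morphism → Word → Word
apply φ w = concatMap φ w

power : ℕ → Morphism → Morphism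
power zero    φ a = a ∷ []
power (suc k) φ a = apply φ (power k φ a)

InA₁ : Morphism → Set
InA₁ φ = Σ Word λ p → Σ Word λ s →
  ¬ (p ≡ []) × IsAntipalindrome s × φ false ≡ p ++ s × φ true ≡ E p ++ s

Primitive : Morphism → Set
Primitive φ = ∃[ k ] ((a : Bool) → (false ∈ power k φ a) × (true ∈ power k φ a))

slice : InfWord → ℕ → ℕ → Word
slice u i zero    = []
slice u i (suc n) = u i ∷ slice u (suc i) n

prefix : InfWord → ℕ → Word
prefix u n = slice u 0 n

-- φ(u) = u: for every prefix v of u, φ(v) is a prefix of u
-- (φ(u) is the limit of φ(prefix u n)).
IsFixedPoint : Morphism → InfWord → Set
IsFixedPoint φ u = (n : ℕ) → apply φ (prefix u n) ≡ prefix u (length (apply φ (prefix u n)))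

IsFactor : Word → InfWord → Set
IsFactor w u = ∃[ i ] (slice u i (length w) ≡ w)

-- The set of factors of u contains infinitely many antipalindromes
-- (equivalently, since there are finitely many words of each length:
-- antipalindromic factors of unbounded length).
InfinitelyManyAntipalindromicFactors : InfWord → Set
InfinitelyManyAntipalindromicFactors u =
  (n : ℕ) → ∃[ w ] (length w ≥ n × IsFactor w u × IsAntipalindrome w)

module Submission where

-- Let φ(0) = p s, φ(1) = E(p) s with p ≠ ε and s an antipalindrome, and let
-- L = |p| + |s|, so that φ is L-uniform.  The proof rests on one identity,
--     E(φ(w)) s = s φ(E(w))      for every word w,
-- which shows that s φ(w) is an antipalindrome whenever w is.  In the fixed
-- point u, the factor w at position i ≥ 1 is mapped by φ onto the factor at
-- position iL, and the block φ(u(i-1)) just before it ends in s; hence s φ(w)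
-- is again a factor of u at a positive position.  Primitivity gives L ≥ 2, so
-- this step strictly increases the length, and it also shows that u is not
-- constant after position 1, which yields a first antipalindrome ab (a ≠ b).
-- Iterating the step produces antipalindromic factors of unbounded length.

open import Defs
open import Data.Bool using (Bool; true; false; not) renaming (_≟_ to _≟ᵇ_)
open import Data.Bool.Properties using (not-involutive; not-¬)
open import Data.Nat using (ℕ; zero; suc; _+_; _*_; _∸_; _^_; _≤_; _≥_; z≤n; s≤s; _≤?_)
open import Data.Nat.Properties
  using (≤-refl; ≤-trans; ≤-reflexive; ≰⇒>; m≤n+m; n≤1+n; +-mono-≤; *-monoʳ-≤; ^-monoˡ-≤; ^-zeroˡ;
         +-assoc; +-comm; +-identityʳ; +-suc; *-comm; *-identityˡ; *-distribʳ-+; m+[n∸m]≡n; suc-injective; <⇒≱)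
open import Data.List using (List; []; _∷_; _++_; map; reverse; length)
open import Data.List.Properties
  using (map-++; map-∘; map-cong; map-id; reverse-++; reverse-map; reverse-involutive; unfold-reverse;
         length-++; length-map; length-reverse; ++-assoc; ++-identityʳ; ++-cancelˡ; ∷-injectiveʳ)
open import Data.List.Relation.Unary.All as All using (All; []; _∷_)
open import Data.List.Relation.Unary.All.Properties using (++⁺; ++⁻ʳ)
open import Data.List.Relation.Unary.Any using (here; there)
open import Data.List.Membership.Propositional using (_∈_)
open import Data.Product using (Σ; _×_; ∃-syntax; _,_; proj₁; proj₂)
open import Data.Sum using (_⊎_; inj₁; inj₂)
open import Relation.Binary.PropositionalEquality
open import Relation.Nullary using (¬_; yes; no; contradiction)

E-++ : (x y : Word) → E (x ++ y) ≡ E y ++ E x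
E-++ x y = trans (cong reverse (map-++ not x y)) (reverse-++ (map not x) (map not y))

E-involutive : (x : Word) → E (E x) ≡ x
E-involutive x = begin
    reverse (map not (reverse (map not x)))   ≡⟨ cong reverse (reverse-map not (map not x)) ⟩
    reverse (reverse (map not (map not x)))   ≡⟨ reverse-involutive _ ⟩
    map not (map not x)                       ≡⟨ sym (map-∘ x) ⟩
    map (λ b → not (not b)) x                 ≡⟨ map-cong not-involutive x ⟩
    map (λ b → b) x                           ≡⟨ map-id x ⟩
    x                                         ∎
  where open ≡-Reasoning

E-∷ : (a : Bool) (w : Word) → E (a ∷ w) ≡ E w ++ (not a ∷ [])
E-∷ a w = unfold-reverse (not a) (map not w)

length-E : (x : Word) → length (E x) ≡ length x
length-E x = trans (length-reverse (map not x)) (length-map not x)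

distinct-pair-antipalindrome : (a b : Bool) → ¬ (a ≡ b) → IsAntipalindrome (a ∷ b ∷ [])
distinct-pair-antipalindrome false false a≢b = contradiction refl a≢b
distinct-pair-antipalindrome false true  _   = refl
distinct-pair-antipalindrome true  false _   = refl
distinct-pair-antipalindrome true  true  a≢b = contradiction refl a≢b

++-cancelˡ-length : (x y x′ y′ : Word) → length x ≡ length y → x ++ x′ ≡ y ++ y′ → x′ ≡ y′
++-cancelˡ-length []      []      _  _  _   eq = eq
++-cancelˡ-length (_ ∷ x) (_ ∷ y) x′ y′ len eq =
  ++-cancelˡ-length x y x′ y′ (suc-injective len) (∷-injectiveʳ eq)

both-letters⇒length≥2 : {w : Word} → false ∈ w → true ∈ w → 2 ≤ length w
both-letters⇒length≥2 {_ ∷ _ ∷ _} _          _         = s≤s (s≤s z≤n)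
both-letters⇒length≥2 {_ ∷ []}    (here refl) (here ())
both-letters⇒length≥2 {_ ∷ []}    _          (there ())
both-letters⇒length≥2 {_ ∷ []}    (there ()) _

length-slice : (u : InfWord) (i n : ℕ) → length (slice u i n) ≡ n
length-slice u i zero    = refl
length-slice u i (suc n) = cong suc (length-slice u (suc i) n)

slice-++ : (u : InfWord) (i a b : ℕ) → slice u i (a + b) ≡ slice u i a ++ slice u (i + a) b
slice-++ u i zero    b = cong (λ k → slice u k b) (sym (+-identityʳ i))
slice-++ u i (suc a) b = cong (u i ∷_) (trans (slice-++ u (suc i) a b)
  (cong (λ k → slice u (suc i) a ++ slice u k b) (sym (+-suc i a))))

ChangeFrom : InfWord → ℕ → Set
ChangeFrom u i = ∃[ j ] (i ≤ j × ¬ (u j ≡ u (suc j)))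

change-or-constant : (u : InfWord) (i k : ℕ) → ChangeFrom u i ⊎ All (_≡ u i) (slice u i k)
change-or-constant u i zero = inj₂ []
change-or-constant u i (suc k) with change-or-constant u (suc i) k
... | inj₁ (j , i<j , change) = inj₁ (j , ≤-trans (n≤1+n i) i<j , change)
... | inj₂ constant with u i ≟ᵇ u (suc i)
...   | yes same = inj₂ (refl ∷ All.map (λ eq → trans eq (sym same)) constant)
...   | no  diff = inj₁ (i , ≤-refl , diff)

module _ (φ : Morphism) where

  apply-++ : (x y : Word) → apply φ (x ++ y) ≡ apply φ x ++ apply φ y
  apply-++ []      y = refl
  apply-++ (a ∷ x) y =
    trans (cong (φ a ++_) (apply-++ x y)) (sym (++-assoc (φ a) (apply φ x) (apply φ y)))

  constant-power : (b : Bool) → All (_≡ b) (φ b) → (k : ℕ) → All (_≡ b) (power k φ b)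
  constant-power b image zero    = refl ∷ []
  constant-power b image (suc k) = go (power k φ b) (constant-power b image k)
    where
    go : (w : Word) → All (_≡ b) w → All (_≡ b) (apply φ w)
    go []      []           = []
    go (_ ∷ w) (refl ∷ all) = ++⁺ image (go w all)

  primitive⇒non-constant-image : Primitive φ → (b : Bool) → ¬ All (_≡ b) (φ b)
  primitive⇒non-constant-image (k , both) b image =
    not-¬ refl (sym (All.lookup (constant-power b image k) (other-letter b (both b))))
    where
    other-letter : (c : Bool) {w : Word} → false ∈ w × true ∈ w → not c ∈ w
    other-letter false (_ , t) = t
    other-letter true  (f , _) = f

  Uniform : ℕ → Set
  Uniform L = (a : Bool) → length (φ a) ≡ L

  module _ {L : ℕ} (uniform : Uniform L) where

    length-apply : (w : Word) → length (apply φ w) ≡ length w * L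
    length-apply []      = refl
    length-apply (a ∷ w) = trans (length-++ (φ a)) (cong₂ _+_ (uniform a) (length-apply w))

    length-power : (k : ℕ) (a : Bool) → length (power k φ a) ≡ L ^ k
    length-power zero    a = refl
    length-power (suc k) a =
      trans (length-apply (power k φ a)) (trans (cong (_* L) (length-power k a)) (*-comm (L ^ k) L))

    -- A primitive uniform morphism has length at least 2: φᵏ(0) contains both
    -- letters, while L ≤ 1 would force |φᵏ(0)| = Lᵏ ≤ 1.
    primitive⇒length≥2 : Primitive φ → 2 ≤ L
    primitive⇒length≥2 (k , both) with 2 ≤? L
    ... | yes 2≤L = 2≤L
    ... | no  2≰L = contradiction (≤-trans two≤ (^-monoˡ-≤ k L≤1)) (<⇒≱ (s≤s (≤-reflexive (^-zeroˡ k))))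
      where
      L≤1 : L ≤ 1
      L≤1 with ≰⇒> 2≰L
      ... | s≤s L≤1 = L≤1
      two≤ : 2 ≤ L ^ k
      two≤ = subst (2 ≤_) (length-power k false)
               (both-letters⇒length≥2 (proj₁ (both false)) (proj₂ (both false)))

    module _ (u : InfWord) (fixed : IsFixedPoint φ u) where

      image-of-prefix : (n : ℕ) → apply φ (prefix u n) ≡ prefix u (n * L)
      image-of-prefix n = trans (fixed n)
        (cong (prefix u) (trans (length-apply (prefix u n)) (cong (_* L) (length-slice u 0 n))))

      image-of-slice : (i m : ℕ) → apply φ (slice u i m) ≡ slice u (i * L) (m * L)
      image-of-slice i m = ++-cancelˡ (apply φ (prefix u i)) _ _ (begin
          apply φ (prefix u i) ++ apply φ (slice u i m)  ≡⟨ sym (apply-++ (prefix u i) (slice u i m)) ⟩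
          apply φ (prefix u i ++ slice u i m)            ≡⟨ cong (apply φ) (sym (slice-++ u 0 i m)) ⟩
          apply φ (prefix u (i + m))                     ≡⟨ image-of-prefix (i + m) ⟩
          prefix u ((i + m) * L)                         ≡⟨ cong (prefix u) (*-distribʳ-+ L i m) ⟩
          prefix u (i * L + m * L)                       ≡⟨ slice-++ u 0 (i * L) (m * L) ⟩
          prefix u (i * L) ++ slice u (i * L) (m * L)    ≡⟨ cong (_++ slice u (i * L) (m * L)) (sym (image-of-prefix i)) ⟩
          apply φ (prefix u i) ++ slice u (i * L) (m * L) ∎)
        where open ≡-Reasoning

      block : (i : ℕ) → slice u (i * L) L ≡ φ (u i)
      block i = begin
          slice u (i * L) L        ≡⟨ cong (slice u (i * L)) (sym (*-identityˡ L)) ⟩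
          slice u (i * L) (1 * L)  ≡⟨ sym (image-of-slice i 1) ⟩
          φ (u i) ++ []            ≡⟨ ++-identityʳ _ ⟩
          φ (u i)                  ∎
        where open ≡-Reasoning

      -- For primitive φ, u changes letter at some position j ≥ 1: otherwise
      -- u(1) ⋯ u(2L-1) would be constant, and so would φ(u(1)) = u(L) ⋯ u(2L-1).
      primitive⇒change-from-1 : Primitive φ → ChangeFrom u 1
      primitive⇒change-from-1 prim with change-or-constant u 1 ((L ∸ 1) + L)
      ... | inj₁ change   = change
      ... | inj₂ constant = contradiction (subst (All (_≡ u 1)) (block 1) second-block)
                                          (primitive⇒non-constant-image prim (u 1))
        where
        L≥1 : 1 ≤ L
        L≥1 = ≤-trans (s≤s z≤n) (primitive⇒length≥2 prim)
        second-block : All (_≡ u 1) (slice u (1 * L) L)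
        second-block = subst (λ k → All (_≡ u 1) (slice u k L)) (trans (m+[n∸m]≡n L≥1) (sym (*-identityˡ L)))
          (++⁻ʳ (slice u 1 (L ∸ 1)) (subst (All (_≡ u 1)) (slice-++ u 1 (L ∸ 1) L) constant))

-- A morphism of class A₁, given by the data φ(0) = p s and φ(1) = E(p) s.
-- (The hypothesis p ≠ ε is only needed for the final iteration.)
module ClassA₁ (φ : Morphism) (p s : Word) (s-anti : IsAntipalindrome s)
               (φ0 : φ false ≡ p ++ s) (φ1 : φ true ≡ E p ++ s) where

  L : ℕ
  L = length p + length s

  uniform : Uniform φ L
  uniform false = trans (cong length φ0) (length-++ p)
  uniform true  = trans (cong length φ1) (trans (length-++ (E p)) (cong (_+ length s) (length-E p)))

  image-shape : (a : Bool) → Σ Word λ q → length q ≡ length p × φ a ≡ q ++ s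
  image-shape false = p , refl , φ0
  image-shape true  = E p , length-E p , φ1

  E-image-letter : (a : Bool) → E (φ a) ++ s ≡ s ++ φ (not a)
  E-image-letter false = begin
      E (φ false) ++ s    ≡⟨ cong (λ z → E z ++ s) φ0 ⟩
      E (p ++ s) ++ s     ≡⟨ cong (_++ s) (E-++ p s) ⟩
      (E s ++ E p) ++ s   ≡⟨ cong (λ z → (z ++ E p) ++ s) s-anti ⟩
      (s ++ E p) ++ s     ≡⟨ ++-assoc s (E p) s ⟩
      s ++ (E p ++ s)     ≡⟨ cong (s ++_) (sym φ1) ⟩
      s ++ φ true         ∎
    where open ≡-Reasoning
  E-image-letter true = begin
      E (φ true) ++ s       ≡⟨ cong (λ z → E z ++ s) φ1 ⟩
      E (E p ++ s) ++ s     ≡⟨ cong (_++ s) (E-++ (E p) s) ⟩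
      (E s ++ E (E p)) ++ s ≡⟨ cong₂ (λ z y → (z ++ y) ++ s) s-anti (E-involutive p) ⟩
      (s ++ p) ++ s         ≡⟨ ++-assoc s p s ⟩
      s ++ (p ++ s)         ≡⟨ cong (s ++_) (sym φ0) ⟩
      s ++ φ false          ∎
    where open ≡-Reasoning

  E-image : (w : Word) → E (apply φ w) ++ s ≡ s ++ apply φ (E w)
  E-image []      = sym (++-identityʳ s)
  E-image (a ∷ w) = begin
      E (φ a ++ apply φ w) ++ s                ≡⟨ cong (_++ s) (E-++ (φ a) (apply φ w)) ⟩
      (E (apply φ w) ++ E (φ a)) ++ s          ≡⟨ ++-assoc (E (apply φ w)) (E (φ a)) s ⟩
      E (apply φ w) ++ (E (φ a) ++ s)          ≡⟨ cong (E (apply φ w) ++_) (E-image-letter a) ⟩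
      E (apply φ w) ++ (s ++ φ (not a))        ≡⟨ sym (++-assoc (E (apply φ w)) s (φ (not a))) ⟩
      (E (apply φ w) ++ s) ++ φ (not a)        ≡⟨ cong (_++ φ (not a)) (E-image w) ⟩
      (s ++ apply φ (E w)) ++ φ (not a)        ≡⟨ ++-assoc s (apply φ (E w)) (φ (not a)) ⟩
      s ++ (apply φ (E w) ++ φ (not a))        ≡⟨ cong (λ z → s ++ (apply φ (E w) ++ z)) (sym (++-identityʳ (φ (not a)))) ⟩
      s ++ (apply φ (E w) ++ apply φ (not a ∷ [])) ≡⟨ cong (s ++_) (sym (apply-++ φ (E w) (not a ∷ []))) ⟩
      s ++ apply φ (E w ++ (not a ∷ []))      ≡⟨ cong (λ z → s ++ apply φ z) (sym (E-∷ a w)) ⟩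
      s ++ apply φ (E (a ∷ w))                ∎
    where open ≡-Reasoning

  antipalindrome-step : (w : Word) → IsAntipalindrome w → IsAntipalindrome (s ++ apply φ w)
  antipalindrome-step w w-anti = begin
      E (s ++ apply φ w)    ≡⟨ E-++ s (apply φ w) ⟩
      E (apply φ w) ++ E s  ≡⟨ cong (E (apply φ w) ++_) s-anti ⟩
      E (apply φ w) ++ s    ≡⟨ E-image w ⟩
      s ++ apply φ (E w)    ≡⟨ cong (λ z → s ++ apply φ z) w-anti ⟩
      s ++ apply φ w        ∎
    where open ≡-Reasoning

  module FixedPoint (u : InfWord) (fixed : IsFixedPoint φ u) where

    s-in-block : (i : ℕ) → slice u (i * L + length p) (length s) ≡ s
    s-in-block i with image-shape (u i)
    ... | q , |q|≡|p| , φui = ++-cancelˡ-length (slice u (i * L) (length p)) q _ s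
          (trans (length-slice u _ _) (sym |q|≡|p|))
          (begin
            slice u (i * L) (length p) ++ slice u (i * L + length p) (length s) ≡⟨ sym (slice-++ u (i * L) (length p) (length s)) ⟩
            slice u (i * L) L                                                   ≡⟨ block φ uniform u fixed i ⟩
            φ (u i)                                                             ≡⟨ φui ⟩
            q ++ s                                                              ∎)
      where open ≡-Reasoning

    -- If w is the factor of length m at position i + 1, then s φ(w) is the
    -- factor at position iL + |p|, namely the tail s of the block φ(u(i))
    -- followed by the image of w.
    preceded-by-s : (i m : ℕ) →
      slice u (i * L + length p) (length s + m * L) ≡ s ++ apply φ (slice u (suc i) m)
    preceded-by-s i m = begin
        slice u (i * L + length p) (length s + m * L)
          ≡⟨ slice-++ u _ (length s) (m * L) ⟩
        slice u (i * L + length p) (length s) ++ slice u (i * L + length p + length s) (m * L)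
          ≡⟨ cong₂ _++_ (s-in-block i) (cong (λ k → slice u k (m * L)) next-block) ⟩
        s ++ slice u (suc i * L) (m * L)
          ≡⟨ cong (s ++_) (sym (image-of-slice φ uniform u fixed (suc i) m)) ⟩
        s ++ apply φ (slice u (suc i) m)
          ∎
      where
      open ≡-Reasoning
      next-block : i * L + length p + length s ≡ suc i * L
      next-block = trans (+-assoc (i * L) (length p) (length s)) (+-comm (i * L) L)

-- An antipalindromic factor of u of length greater than n, at a positive
-- position (so that it is preceded by a letter of u).
LateAntipalindrome : InfWord → ℕ → Set
LateAntipalindrome u n = Σ ℕ λ i → Σ ℕ λ m → 1 ≤ i × suc n ≤ m × IsAntipalindrome (slice u i m)

longer-image : (n m k L : ℕ) → suc n ≤ m → 2 ≤ L → suc (suc n) ≤ k + m * L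
longer-image n m k L n<m 2≤L = ≤-trans growth (m≤n+m (m * L) k)
  where
  growth : suc (suc n) ≤ m * L
  growth = ≤-trans (≤-reflexive (+-comm 1 (suc n)))
           (≤-trans (+-mono-≤ n<m (≤-trans (s≤s z≤n) n<m))
           (≤-trans (≤-reflexive (trans (cong (m +_) (sym (+-identityʳ m))) (*-comm 2 m)))
           (*-monoʳ-≤ m 2≤L)))

module _ (φ : Morphism) (prim : Primitive φ) (p s : Word) (p≢ε : ¬ (p ≡ [])) (s-anti : IsAntipalindrome s)
         (φ0 : φ false ≡ p ++ s) (φ1 : φ true ≡ E p ++ s) (u : InfWord) (fixed : IsFixedPoint φ u) where

  open ClassA₁ φ p s s-anti φ0 φ1
  open FixedPoint u fixed

  late-antipalindrome-base : LateAntipalindrome u 0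
  late-antipalindrome-base with primitive⇒change-from-1 φ uniform u fixed prim
  ... | j , 1≤j , change = j , 2 , 1≤j , s≤s z≤n , distinct-pair-antipalindrome (u j) (u (suc j)) change

  late-antipalindrome-step : (n : ℕ) → LateAntipalindrome u n → LateAntipalindrome u (suc n)
  late-antipalindrome-step n (suc i , m , _ , n<m , w-anti) =
    i * L + length p , length s + m * L ,
    ≤-trans (nonempty⇒length≥1 p p≢ε) (m≤n+m (length p) (i * L)) ,
    longer-image n m (length s) L n<m (primitive⇒length≥2 φ uniform prim) ,
    subst IsAntipalindrome (sym (preceded-by-s i m)) (antipalindrome-step (slice u (suc i) m) w-anti)
    where
    nonempty⇒length≥1 : (q : Word) → ¬ (q ≡ []) → 1 ≤ length q
    nonempty⇒length≥1 []      q≢ε = contradiction refl q≢ε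
    nonempty⇒length≥1 (_ ∷ _) _   = s≤s z≤n

  late-antipalindrome : (n : ℕ) → LateAntipalindrome u n
  late-antipalindrome zero    = late-antipalindrome-base
  late-antipalindrome (suc n) = late-antipalindrome-step n (late-antipalindrome n)

proposition11 : (φ : Morphism) → Primitive φ → InA₁ φ → (u : InfWord) → IsFixedPoint φ u →
    InfinitelyManyAntipalindromicFactors u
proposition11 φ prim (p , s , p≢ε , s-anti , φ0 , φ1) u fixed n
  with late-antipalindrome φ prim p s p≢ε s-anti φ0 φ1 u fixed n
... | i , m , _ , n<m , w-anti =
  slice u i m ,
  subst (_≥ n) (sym (length-slice u i m)) (≤-trans (n≤1+n n) n<m) ,
  (i , cong (slice u i) (length-slice u i m)) ,
  w-anti
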